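{- Let $\mathcal{A}$ be an alphabet of size $n\geq 2$ and let $l$ be an even positive integer. Then $$\varepsilon_1(n,l)=n^{l/2}\,\pi_n(l)-\sum_{d\in \Lambda^+(l)} \pi_n\!\left(\frac{3l}{d}\right).$$
   Context: A nonempty word $u$ is primitive if $u=v^m$ with $m$ a positive integer implies $m=1$; $|u|$ is the length of $u$. $\pi_n(k)$ denotes the number of primitive words of length $k$ over an alphabet of size $n$. $\Lambda(l)=\{d\ :\ d\mid l,\ d\not\equiv 0 \pmod 3,\ d\geq 4\}$ and $\Lambda^+(l)$ is the set of even elements of $\Lambda(l)$. Let $\mathcal{E}(\mathcal{A},l)$ be the set of pairs $(p,q)$ of primitive words over $\mathcal{A}$ with $|p|=2|q|=2l$ and $pq$ not primitive. $\mathcal{E}_1(\mathcal{A},l)$ is the set of those $(p,q)\in\mathcal{E}(\mathcal{A},l)$ such that $p=xqx$ for some nonempty word $x$ with $xq$ primitive and $|q|=2|x|$. $\varepsilon_1(n,l)$ is the cardinality of $\mathcal{E}_1(\mathcal{A},l)$. -}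

module Defs where

open import Data.Nat using (ℕ; zero; suc; _+_; _*_; _≤_; _/_)
open import Data.Nat.Divisibility using (_∣_; _∣?_)
open import Data.Nat.Properties using (_≤?_)
open import Data.Fin using (Fin)
open import Data.List using (List; []; _++_; length; concat; replicate; map; upTo)
open import Data.Nat.ListAction using (sum)
open import Data.List.Membership.Propositional using (_∈_)
open import Data.List.Relation.Unary.Unique.Propositional using (Unique)
open import Data.Product using (Σ; _×_; ∃-syntax)
open import Function.Bundles using (_⇔_)
open import Relation.Binary.PropositionalEquality using (_≡_; _≢_)
open import Relation.Nullary using (¬_; Dec)
open import Relation.Nullary.Decidable using (_×-dec_; ¬?; ⌊_⌋)
open import Data.Bool using (if_then_else_)

Word : ℕ → Set
Word n = List (Fin n)

_^^_ : ∀ {n} → Word n → ℕ → Word n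
v ^^ m = concat (replicate m v)

Primitive : ∀ {n} → Word n → Set
Primitive {n} u = (u ≢ []) × (∀ (v : Word n) (m : ℕ) → 1 ≤ m → u ≡ v ^^ m → m ≡ 1)

HasCount : {A : Set} → (A → Set) → ℕ → Set
HasCount {A} P c = Σ (List A) λ xs → Unique xs × (length xs ≡ c) × (∀ x → (x ∈ xs) ⇔ P x)

PrimOfLength : (n k : ℕ) → Word n → Set
PrimOfLength n k u = (length u ≡ k) × Primitive u

E : (n l : ℕ) → Word n × Word n → Set
E n l (p Data.Product., q) =
  Primitive p × Primitive q × (length p ≡ 2 * l) × (length q ≡ l) × ¬ Primitive (p ++ q)

E₁ : (n l : ℕ) → Word n × Word n → Set
E₁ n l (p Data.Product., q) =
  E n l (p Data.Product., q) ×
  (∃[ x ] ((x ≢ []) × (p ≡ x ++ q ++ x) × Primitive (x ++ q) × (length q ≡ 2 * length x)))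

InΛ⁺ : ℕ → ℕ → Set
InΛ⁺ l d = (d ∣ l) × ¬ (3 ∣ d) × (4 ≤ d) × (2 ∣ d)

inΛ⁺? : ∀ l d → Dec (InΛ⁺ l d)
inΛ⁺? l d = (d ∣? l) ×-dec (¬? (3 ∣? d) ×-dec ((4 ≤? d) ×-dec (2 ∣? d)))

Λ⁺term : (ℕ → ℕ) → ℕ → ℕ → ℕ
Λ⁺term π l zero = 0
Λ⁺term π l (suc e) = if ⌊ inΛ⁺? l (suc e) ⌋ then π ((3 * l) / suc e) else 0

-- Σ_{d ∈ Λ⁺(l)} π(3l/d), summing over candidates d = 1, …, l (every divisor of l > 0 is ≤ l).
Λ⁺Sum : (ℕ → ℕ) → ℕ → ℕ
Λ⁺Sum π l = sum (map (λ e → Λ⁺term π l (suc e)) (upTo l))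

-- Sending (x , q) to (x q x , q) identifies ℰ₁(𝒜, 2h) with the pairs in which |x| = h, q is primitive
-- of length 2h and x q is primitive: then (x q x) q = (x q)² is not primitive, and x q x is, because by
-- Fine and Wilf a proper root of it, of length at most 2h, would have length a multiple of its period 3h.
-- Of the n^h π(2h) pairs (x , q), those with x q not primitive are exactly the cuts at h of the powers
-- v^t with v primitive, t ≥ 2 and 3 ∤ t (for 3 ∣ t, q itself would be a power of v); then |v| = 3c,
-- h = c t, and d = 2t runs through Λ⁺(2h) with 3·2h/d = |v|. Conversely, again by Fine and Wilf, every
-- such cut has q primitive, and t is determined by x q; this gives the sum over Λ⁺(2h).

module Submission where

open import Defs
open import Data.Nat
  using (ℕ; zero; suc; pred; _+_; _*_; _∸_; _^_; _/_; _≤_; _<_; z≤n; s≤s; _≤?_; _<?_; _≟_; >-nonZero; ≢-nonZero)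
open import Data.Nat.Properties
open import Data.Nat.Divisibility
  using (_∣_; divides; _∣?_; 1∣_; ∣-refl; ∣-antisym; ∣⇒≤; ∣m⇒∣m*n; ∣m+n∣m⇒∣n; ∣m∣n⇒∣m+n; quotient>1)
open import Data.Nat.DivMod using (m*n/n≡m)
open import Data.Nat.Primality using (Prime; prime?; euclidsLemma)
open import Data.Nat.Induction using (<-wellFounded)
open import Data.Nat.ListAction using (sum)
open import Data.Nat.Tactic.RingSolver using (solve-∀)
open import Induction.WellFounded using (Acc; acc)
open import Data.Fin as Fin using (Fin; toℕ; fromℕ<)
open import Data.Fin.Properties using (any?; toℕ-fromℕ<)
open import Data.Maybe using (Maybe; just; nothing)
open import Data.List
  using (List; []; _∷_; _++_; length; take; drop; splitAt; map; filter; upTo; allFin; cartesianProduct; cartesianProductWith)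
open import Data.List.Properties
  using (≡-dec; length-++; length-map; length-tabulate; length-take; length-drop; ++-assoc; ++-identityʳ; ++-conicalʳ;
         take-all; take++drop≡id; splitAt-defn)
open import Data.List.Membership.Propositional using (_∈_)
open import Data.List.Membership.Propositional.Properties
  using (∈-map⁺; ∈-map⁻; ∈-filter⁺; ∈-filter⁻; ++-∈⇔; ∈-cartesianProduct⁺; ∈-cartesianProduct⁻; ∈-allFin; ∈-upTo⁺)
open import Data.List.Membership.Propositional.Properties.WithK using (unique∧set⇒bag)
open import Data.List.Relation.Binary.BagAndSetEquality using (∼bag⇒↭)
open import Data.List.Relation.Binary.Permutation.Propositional.Properties using (↭-length)
open import Data.List.Relation.Unary.Any using (here; there)
open import Data.List.Relation.Unary.All as All using ()
open import Data.List.Relation.Unary.AllPairs using ([]; _∷_)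
open import Data.List.Relation.Unary.Unique.Propositional using (Unique)
import Data.List.Relation.Unary.Unique.Propositional.Properties as Unique
open import Data.Product using (_×_; _,_; proj₁; proj₂; ∃-syntax; uncurry)
open import Data.Sum using (_⊎_; inj₁; inj₂; [_,_]′)
import Data.Sum as Sum
open import Data.Unit using (⊤; tt)
open import Data.Empty using (⊥; ⊥-elim)
open import Function using (_∘_; id)
open import Function.Bundles using (_⇔_; mk⇔; Equivalence)
open Equivalence using (to; from)
import Function.Properties.Equivalence as ⇔
open import Relation.Binary.Definitions using (tri<; tri≈; tri>)
open import Relation.Binary.PropositionalEquality
open import Relation.Nullary using (¬_; Dec; yes; no)
open import Relation.Nullary.Decidable using (¬?; toSum; _×-dec_; from-yes; from-no)
open import Relation.Unary using (Decidable)

-- Counting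

private
  length-cartesianProductWith : ∀ {A B C : Set} (f : A → B → C) xs ys →
    length (cartesianProductWith f xs ys) ≡ length xs * length ys
  length-cartesianProductWith f []       ys = refl
  length-cartesianProductWith f (x ∷ xs) ys =
    trans (length-++ (map (f x) ys)) (cong₂ _+_ (length-map (f x) ys) (length-cartesianProductWith f xs ys))

module _ {A : Set} where

  HasCount-cong : ∀ {P Q : A → Set} {c} → (∀ x → P x ⇔ Q x) → HasCount P c → HasCount Q c
  HasCount-cong P⇔Q (xs , xs! , len , ∈⇔P) = xs , xs! , len , λ x → ⇔.trans (∈⇔P x) (P⇔Q x)

  HasCount-⊎ : ∀ {P Q : A → Set} {a b} → HasCount P a → HasCount Q b → (∀ {x} → P x → Q x → ⊥) →
               HasCount (λ x → P x ⊎ Q x) (a + b)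
  HasCount-⊎ (xs , xs! , refl , ∈⇔P) (ys , ys! , refl , ∈⇔Q) P∩Q=∅ =
    xs ++ ys , Unique.++⁺ xs! ys! disjoint , length-++ xs ,
    λ x → ⇔.trans ++-∈⇔ (mk⇔ (Sum.map (to (∈⇔P x)) (to (∈⇔Q x))) (Sum.map (from (∈⇔P x)) (from (∈⇔Q x))))
    where
    disjoint : ∀ {x} → x ∈ xs × x ∈ ys → ⊥
    disjoint {x} (x∈xs , x∈ys) = P∩Q=∅ (to (∈⇔P x) x∈xs) (to (∈⇔Q x) x∈ys)

  count-unique : ∀ {P : A → Set} {a b} → HasCount P a → HasCount P b → a ≡ b
  count-unique (xs , xs! , refl , ∈xs⇔) (ys , ys! , refl , ∈ys⇔) =
    ↭-length (∼bag⇒↭ (unique∧set⇒bag xs! ys! λ {x} → ⇔.trans (∈xs⇔ x) (⇔.sym (∈ys⇔ x))))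

  HasCount-∅ : ∀ {P : A → Set} → (∀ x → ¬ P x) → HasCount P 0
  HasCount-∅ ¬P = [] , [] , refl , λ x → mk⇔ (λ ()) (λ p → ⊥-elim (¬P x p))

  HasCount-filter : ∀ {P Q : A → Set} {a} → Decidable Q → HasCount P a → ∃[ k ] HasCount (λ x → P x × Q x) k
  HasCount-filter Q? (xs , xs! , _ , ∈⇔P) =
    _ , filter Q? xs , Unique.filter⁺ Q? xs! , refl ,
    λ x → mk⇔ (λ x∈ → let x∈xs , q = ∈-filter⁻ Q? x∈ in to (∈⇔P x) x∈xs , q)
              (λ (p , q) → ∈-filter⁺ Q? (from (∈⇔P x) p) q)

  HasCount-∖ : ∀ {P Q : A → Set} {a b} → Decidable Q →
               HasCount P a → HasCount (λ x → P x × ¬ Q x) b → HasCount (λ x → P x × Q x) (a ∸ b)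
  HasCount-∖ {P} {Q} {a} {b} Q? P-count ¬Q-count
    with k , Q-count ← HasCount-filter Q? P-count
       | k′ , ¬Q-count′ ← HasCount-filter (¬? ∘ Q?) P-count = subst (HasCount _) k≡a∸b Q-count
    where
    split : ∀ x → (P x × Q x ⊎ P x × ¬ Q x) ⇔ P x
    split x = mk⇔ [ proj₁ , proj₁ ]′ λ p → Sum.map (p ,_) (p ,_) (toSum (Q? x))
    k+k′≡a : k + k′ ≡ a
    k+k′≡a = count-unique (HasCount-cong split (HasCount-⊎ Q-count ¬Q-count′ λ (_ , q) (_ , ¬q) → ¬q q)) P-count
    k≡a∸b : k ≡ a ∸ b
    k≡a∸b = trans (sym (m+n∸n≡m k k′)) (cong₂ _∸_ k+k′≡a (count-unique ¬Q-count′ ¬Q-count))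

  HasCount-image : ∀ {B : Set} {P : A → Set} {c} (f : A → B) → (∀ {x y} → f x ≡ f y → x ≡ y) →
                   HasCount P c → HasCount (λ y → ∃[ x ] (P x × y ≡ f x)) c
  HasCount-image f f-injective (xs , xs! , refl , ∈⇔P) =
    map f xs , Unique.map⁺ f-injective xs! , length-map f xs ,
    λ y → mk⇔ (λ y∈ → let x , x∈xs , y≡fx = ∈-map⁻ f y∈ in x , to (∈⇔P x) x∈xs , y≡fx)
              (λ { (x , p , refl) → ∈-map⁺ f (from (∈⇔P x) p) })

  HasCount-× : ∀ {B : Set} {P : A → Set} {Q : B → Set} {a b} → HasCount P a → HasCount Q b →
               HasCount (λ z → P (proj₁ z) × Q (proj₂ z)) (a * b)
  HasCount-× (xs , xs! , refl , ∈⇔P) (ys , ys! , refl , ∈⇔Q) =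
    cartesianProduct xs ys , Unique.cartesianProduct⁺ xs! ys! , length-cartesianProductWith _,_ xs ys ,
    λ (x , y) → mk⇔ (λ xy∈ → let x∈ , y∈ = ∈-cartesianProduct⁻ xs ys xy∈ in to (∈⇔P x) x∈ , to (∈⇔Q y) y∈)
                    (λ (p , q) → ∈-cartesianProduct⁺ (from (∈⇔P x) p) (from (∈⇔Q y) q))

  HasCount-⋃ : ∀ {I : Set} {Q : I → A → Set} {c : I → ℕ} (is : List I) → Unique is →
               (∀ i → HasCount (Q i) (c i)) → (∀ {i j x} → Q i x → Q j x → i ≡ j) →
               HasCount (λ x → ∃[ i ] (i ∈ is × Q i x)) (sum (map c is))
  HasCount-⋃ [] _ _ _ = HasCount-∅ λ { x (_ , () , _) }
  HasCount-⋃ {Q = Q} (i ∷ is) (i∉is ∷ is!) Q-count Q-disjoint =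
    HasCount-cong cons⇔
      (HasCount-⊎ (Q-count i) (HasCount-⋃ is is! Q-count Q-disjoint)
        λ { q (j , j∈is , q′) → All.lookup i∉is j∈is (Q-disjoint q q′) })
    where
    cons⇔ : ∀ x → (Q i x ⊎ ∃[ j ] (j ∈ is × Q j x)) ⇔ (∃[ j ] (j ∈ i ∷ is × Q j x))
    cons⇔ x = mk⇔ [ (λ q → i , here refl , q) , (λ (j , j∈ , q) → j , there j∈ , q) ]′
                   λ { (j , here refl , q) → inj₁ q ; (j , there j∈ , q) → inj₂ (j , j∈ , q) }

HasCount-⊤ : ∀ n → HasCount (λ (_ : Fin n) → ⊤) n
HasCount-⊤ n = allFin n , Unique.allFin⁺ n , length-tabulate id , λ i → mk⇔ (λ _ → tt) (λ _ → ∈-allFin i)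

HasCount-length : ∀ {n} k → HasCount (λ (w : Word n) → length w ≡ k) (n ^ k)
HasCount-length zero = [] ∷ [] , All.[] ∷ [] , refl , λ where
  []      → mk⇔ (λ _ → refl) (λ _ → here refl)
  (_ ∷ _) → mk⇔ (λ { (here ()) ; (there ()) }) (λ ())
HasCount-length {n} (suc k) =
  HasCount-cong cons⇔ (HasCount-image (uncurry _∷_) ∷-injective (HasCount-× (HasCount-⊤ n) (HasCount-length k)))
  where
  ∷-injective : ∀ {x y : Fin n × Word n} → uncurry _∷_ x ≡ uncurry _∷_ y → x ≡ y
  ∷-injective refl = refl
  cons⇔ : ∀ w → (∃[ z ] ((⊤ × length (proj₂ z) ≡ k) × w ≡ uncurry _∷_ z)) ⇔ (length w ≡ suc k)
  cons⇔ []      = mk⇔ (λ { (_ , _ , ()) }) (λ ())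
  cons⇔ (a ∷ w) = mk⇔ (λ { (_ , (_ , len) , refl) → cong suc len }) λ len → (a , w) , (tt , suc-injective len) , refl

-- Periods and the theorem of Fine and Wilf

private
  m<o∸n⇒m+n<o : ∀ m n o → m < o ∸ n → m + n < o
  m<o∸n⇒m+n<o m zero    o       lt       = subst (_< o) (sym (+-identityʳ m)) lt
  m<o∸n⇒m+n<o m (suc n) (suc o) lt       = subst (_< suc o) (sym (+-suc m n)) (s≤s (m<o∸n⇒m+n<o m n o lt))

  m+n<o⇒m<o∸n : ∀ m n o → m + n < o → m < o ∸ n
  m+n<o⇒m<o∸n m n o = m+n≤o⇒m≤o∸n (suc m)

  m<m+n⇒1≤n : ∀ {m n} → m < m + n → 1 ≤ n
  m<m+n⇒1≤n {m} {n} m<m+n = +-cancelˡ-< m 0 n (subst (_< m + n) (sym (+-identityʳ m)) m<m+n)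

  ∣m∣n⇒∣m∸n : ∀ {d m n} → d ∣ m → d ∣ n → d ∣ m ∸ n
  ∣m∣n⇒∣m∸n {d} (divides p refl) (divides q refl) = divides (p ∸ q) (sym (*-distribʳ-∸ d p q))

module _ {A : Set} where

  at : List A → ℕ → Maybe A
  at []       _       = nothing
  at (x ∷ xs) zero    = just x
  at (x ∷ xs) (suc i) = at xs i

  at-++ˡ : ∀ (xs ys : List A) {i} → i < length xs → at (xs ++ ys) i ≡ at xs i
  at-++ˡ (x ∷ xs) ys {zero}  _         = refl
  at-++ˡ (x ∷ xs) ys {suc i} (s≤s i<) = at-++ˡ xs ys i<

  at-++ʳ : ∀ (xs ys : List A) i → at (xs ++ ys) (length xs + i) ≡ at ys i
  at-++ʳ []       ys i = refl
  at-++ʳ (x ∷ xs) ys i = at-++ʳ xs ys i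

  at-take : ∀ k (xs : List A) {i} → i < k → at (take k xs) i ≡ at xs i
  at-take (suc k) []       _         = refl
  at-take (suc k) (x ∷ xs) {zero}  _ = refl
  at-take (suc k) (x ∷ xs) {suc i} (s≤s i<k) = at-take k xs i<k

  at-drop : ∀ k (xs : List A) i → at (drop k xs) i ≡ at xs (k + i)
  at-drop zero    xs       i = refl
  at-drop (suc k) []       i = refl
  at-drop (suc k) (x ∷ xs) i = at-drop k xs i

  at-extensional : ∀ (xs ys : List A) → length xs ≡ length ys →
                   (∀ i → i < length xs → at xs i ≡ at ys i) → xs ≡ ys
  at-extensional []       []       _   _    = refl
  at-extensional (x ∷ xs) (y ∷ ys) len same with same 0 (s≤s z≤n)
  ... | refl = cong (x ∷_) (at-extensional xs ys (suc-injective len) λ i i< → same (suc i) (s≤s i<))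

  take-length-++ : ∀ (xs ys : List A) → take (length xs) (xs ++ ys) ≡ xs
  take-length-++ []       ys = refl
  take-length-++ (x ∷ xs) ys = cong (x ∷_) (take-length-++ xs ys)

  drop-length-++ : ∀ (xs ys : List A) → drop (length xs) (xs ++ ys) ≡ ys
  drop-length-++ []       ys = refl
  drop-length-++ (x ∷ xs) ys = drop-length-++ xs ys

  drop-++-≤ : ∀ k (xs ys : List A) → k ≤ length xs → drop k (xs ++ ys) ≡ drop k xs ++ ys
  drop-++-≤ zero    xs       ys _         = refl
  drop-++-≤ (suc k) (x ∷ xs) ys (s≤s k≤) = drop-++-≤ k xs ys k≤

  drop-++-≥ : ∀ k (xs ys : List A) → length xs ≤ k → drop k (xs ++ ys) ≡ drop (k ∸ length xs) ys
  drop-++-≥ k       []       ys _         = refl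
  drop-++-≥ (suc k) (x ∷ xs) ys (s≤s ≤k) = drop-++-≥ k xs ys ≤k

  splitAt-injective : ∀ k {xs ys : List A} → splitAt k xs ≡ splitAt k ys → xs ≡ ys
  splitAt-injective k {xs} {ys} eq = begin
    xs                     ≡⟨ take++drop≡id k xs ⟨
    take k xs ++ drop k xs ≡⟨ cong (uncurry _++_) (trans (sym (splitAt-defn k xs)) (trans eq (splitAt-defn k ys))) ⟩
    take k ys ++ drop k ys ≡⟨ take++drop≡id k ys ⟩
    ys                     ∎
    where open ≡-Reasoning

  length-take-≤ : ∀ k (xs : List A) → k ≤ length xs → length (take k xs) ≡ k
  length-take-≤ k xs k≤ = trans (length-take k xs) (m≤n⇒m⊓n≡m k≤)

  HasPeriod : ℕ → List A → Set
  HasPeriod p w = ∀ i → i + p < length w → at w i ≡ at w (i + p)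

  HasPeriod-take : ∀ {p} k (w : List A) → HasPeriod p w → HasPeriod p (take k w)
  HasPeriod-take {p} k w period i i+p< = begin
    at (take k w) i        ≡⟨ at-take k w (≤-<-trans (m≤m+n i p) i+p<k) ⟩
    at w i                 ≡⟨ period i i+p<w ⟩
    at w (i + p)           ≡⟨ at-take k w i+p<k ⟨
    at (take k w) (i + p)  ∎
    where
    open ≡-Reasoning
    i+p<k⊓w = subst (i + p <_) (length-take k w) i+p<
    i+p<k = m<n⊓o⇒m<n k (length w) i+p<k⊓w
    i+p<w = m<n⊓o⇒m<o k (length w) i+p<k⊓w

  HasPeriod-drop : ∀ {p} k (w : List A) → HasPeriod p w → HasPeriod p (drop k w)
  HasPeriod-drop {p} k w period i i+p< = begin
    at (drop k w) i        ≡⟨ at-drop k w i ⟩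
    at w (k + i)           ≡⟨ period (k + i) k+i+p<w ⟩
    at w (k + i + p)       ≡⟨ cong (at w) (+-assoc k i p) ⟩
    at w (k + (i + p))     ≡⟨ at-drop k w (i + p) ⟨
    at (drop k w) (i + p)  ∎
    where
    open ≡-Reasoning
    k+i+p<w : k + i + p < length w
    k+i+p<w = subst (_< length w) (trans (+-comm (i + p) k) (sym (+-assoc k i p)))
                (m<o∸n⇒m+n<o (i + p) k (length w) (subst (i + p <_) (length-drop k w) i+p<))

  HasPeriod-+ : ∀ {a b} (w : List A) → HasPeriod a w → HasPeriod b w → HasPeriod (a + b) w
  HasPeriod-+ {a} {b} w period-a period-b i i+[a+b]< = begin
    at w i            ≡⟨ period-a i (≤-<-trans (m≤m+n (i + a) b) i+a+b<) ⟩
    at w (i + a)      ≡⟨ period-b (i + a) i+a+b< ⟩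
    at w (i + a + b)  ≡⟨ cong (at w) (+-assoc i a b) ⟩
    at w (i + (a + b)) ∎
    where
    open ≡-Reasoning
    i+a+b< = subst (_< length w) (sym (+-assoc i a b)) i+[a+b]<

  HasPeriod-* : ∀ {g} k (w : List A) → HasPeriod g w → HasPeriod (k * g) w
  HasPeriod-* zero    w _      i _ = cong (at w) (sym (+-identityʳ i))
  HasPeriod-* (suc k) w period   = HasPeriod-+ w period (HasPeriod-* k w period)

  HasPeriod-∣ : ∀ {g p} (w : List A) → g ∣ p → HasPeriod g w → HasPeriod p w
  HasPeriod-∣ w (divides k refl) = HasPeriod-* k w

  HasPeriod-border : ∀ (x y : List A) → HasPeriod (length (x ++ y)) (x ++ y ++ x)
  HasPeriod-border x y i i+p< = begin
    at (x ++ y ++ x) i                       ≡⟨ at-++ˡ x (y ++ x) i<x ⟩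
    at x i                                   ≡⟨ at-++ʳ (x ++ y) x i ⟨
    at ((x ++ y) ++ x) (length (x ++ y) + i) ≡⟨ cong₂ at (++-assoc x y x) (+-comm (length (x ++ y)) i) ⟩
    at (x ++ y ++ x) (i + length (x ++ y))   ∎
    where
    open ≡-Reasoning
    length-x++y++x : length (x ++ y ++ x) ≡ length x + length (x ++ y)
    length-x++y++x = trans (cong length (sym (++-assoc x y x))) (trans (length-++ (x ++ y)) (+-comm _ (length x)))
    i<x : i < length x
    i<x = +-cancelʳ-< (length (x ++ y)) i (length x) (subst (i + length (x ++ y) <_) length-x++y++x i+p<)

  HasPeriod-∸ : ∀ {a e} (w : List A) → HasPeriod a w → HasPeriod (a + e) w →
                HasPeriod e (take (length w ∸ a) w)
  HasPeriod-∸ {a} {e} w period-a period-a+e i i+e< = begin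
    at (take K w) i        ≡⟨ at-take K w (≤-<-trans (m≤m+n i e) i+e<K) ⟩
    at w i                 ≡⟨ period-a+e i (subst (_< length w) i+e+a≡i+[a+e] i+e+a<w) ⟩
    at w (i + (a + e))     ≡⟨ cong (at w) i+e+a≡i+[a+e] ⟨
    at w (i + e + a)       ≡⟨ period-a (i + e) i+e+a<w ⟨
    at w (i + e)           ≡⟨ at-take K w i+e<K ⟨
    at (take K w) (i + e)  ∎
    where
    open ≡-Reasoning
    K = length w ∸ a
    i+e<K = m<n⊓o⇒m<n K (length w) (subst (i + e <_) (length-take K w) i+e<)
    i+e+a<w = m<o∸n⇒m+n<o (i + e) a (length w) i+e<K
    i+e+a≡i+[a+e] : i + e + a ≡ i + (a + e)
    i+e+a≡i+[a+e] = trans (+-assoc i e a) (cong (i +_) (+-comm e a))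

  HasPeriod-take⁻ : ∀ {g} k (w : List A) → k ≤ length w → HasPeriod g (take k w) →
                    ∀ i → i + g < k → at w i ≡ at w (i + g)
  HasPeriod-take⁻ {g} k w k≤w period i i+g<k = begin
    at w i               ≡⟨ at-take k w (≤-<-trans (m≤m+n i g) i+g<k) ⟨
    at (take k w) i       ≡⟨ period i (subst (i + g <_) (sym (length-take-≤ k w k≤w)) i+g<k) ⟩
    at (take k w) (i + g) ≡⟨ at-take k w i+g<k ⟩
    at w (i + g)          ∎
    where open ≡-Reasoning

  -- A position i ≥ a is moved into the prefix by the period a; if i < a ≤ i + g, then i is compared
  -- with i + g ∸ a, which lies in the prefix and differs from i by a multiple of g.
  HasPeriod-extend : ∀ {a g} (w : List A) → 1 ≤ a → a + a ≤ length w → g ∣ a →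
                     HasPeriod a w → HasPeriod g (take (length w ∸ a) w) → HasPeriod g w
  HasPeriod-extend {a} {g} w a≥1 a+a≤w g∣a period-a period-g′ = period-g
    where
    open ≡-Reasoning
    K = length w ∸ a
    w′ = take K w
    |w′|≡K : length w′ ≡ K
    |w′|≡K = length-take-≤ K w (m∸n≤m (length w) a)
    within : ∀ i → i + g < K → at w i ≡ at w (i + g)
    within = HasPeriod-take⁻ K w (m∸n≤m (length w) a) period-g′
    period-g : HasPeriod g w
    period-g i i+g<w with i + g <? K | a ≤? i
    ... | yes i+g<K | _ = within i i+g<K
    ... | no _ | yes a≤i = begin
      at w i            ≡⟨ cong (at w) j+a≡i ⟨
      at w (j + a)      ≡⟨ period-a j (subst (_< length w) (sym j+a≡i) (≤-<-trans (m≤m+n i g) i+g<w)) ⟨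
      at w j            ≡⟨ within j (m+n<o⇒m<o∸n (j + g) a (length w) j+g+a<w) ⟩
      at w (j + g)      ≡⟨ period-a (j + g) j+g+a<w ⟩
      at w (j + g + a)  ≡⟨ cong (at w) j+g+a≡i+g ⟩
      at w (i + g)      ∎
      where
      j = i ∸ a
      j+a≡i = m∸n+n≡m a≤i
      j+g+a≡i+g : j + g + a ≡ i + g
      j+g+a≡i+g = trans (+-assoc j g a) (trans (cong (j +_) (+-comm g a)) (trans (sym (+-assoc j a g)) (cong (_+ g) j+a≡i)))
      j+g+a<w = subst (_< length w) (sym j+g+a≡i+g) i+g<w
    ... | no i+g≮K | no a≰i = begin
      at w i                  ≡⟨ at-take K w i<K ⟨
      at w′ i                 ≡⟨ cong (at w′) j+[a∸g]≡i ⟨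
      at w′ (j + (a ∸ g))     ≡⟨ HasPeriod-∣ w′ g∣a∸g period-g′ j (subst₂ _<_ (sym j+[a∸g]≡i) (sym |w′|≡K) i<K) ⟨
      at w′ j                 ≡⟨ at-take K w (≤-<-trans j≤i i<K) ⟩
      at w j                  ≡⟨ period-a j (subst (_< length w) (sym j+a≡i+g) i+g<w) ⟩
      at w (j + a)            ≡⟨ cong (at w) j+a≡i+g ⟩
      at w (i + g)            ∎
      where
      a≤K : a ≤ K
      a≤K = m+n≤o⇒m≤o∸n a a+a≤w
      i<K = <-≤-trans (≰⇒> a≰i) a≤K
      j = i + g ∸ a
      j+a≡i+g = m∸n+n≡m (≤-trans a≤K (≮⇒≥ i+g≮K))
      g≤a = ∣⇒≤ {{>-nonZero a≥1}} g∣a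
      j+[a∸g]≡i : j + (a ∸ g) ≡ i
      j+[a∸g]≡i = +-cancelʳ-≡ g _ _ (trans (+-assoc j (a ∸ g) g) (trans (cong (j +_) (m∸n+n≡m g≤a)) j+a≡i+g))
      j≤i = subst (j ≤_) j+[a∸g]≡i (m≤m+n j (a ∸ g))
      g∣a∸g = ∣m∣n⇒∣m∸n g∣a ∣-refl

  CommonPeriod : ℕ → ℕ → List A → Set
  CommonPeriod a b w = ∃[ g ] (g ∣ a × g ∣ b × HasPeriod g w)

  -- One step of Euclid's algorithm on the periods: a + e is replaced by e on the prefix of length |w| ∸ a.
  fine-wilf-step : ∀ {a e d} (w : List A) → 1 ≤ a → 1 ≤ e → d ∣ a → d ∣ a + e → a + (a + e) ≤ length w + d →
                   HasPeriod a w → HasPeriod (a + e) w →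
                   (∀ (w′ : List A) → d ∣ e → a + e ≤ length w′ + d → HasPeriod a w′ → HasPeriod e w′ →
                     CommonPeriod a e w′) →
                   CommonPeriod a (a + e) w
  fine-wilf-step {a} {e} {d} w a≥1 e≥1 d∣a d∣a+e len period-a period-a+e shorter =
    extend (shorter (take (length w ∸ a) w) d∣e len′
              (HasPeriod-take (length w ∸ a) w period-a) (HasPeriod-∸ w period-a period-a+e))
    where
    d∣e = ∣m+n∣m⇒∣n d∣a+e d∣a
    a+a+e≤w+e : a + a + e ≤ length w + e
    a+a+e≤w+e = subst (_≤ length w + e) (sym (+-assoc a a e))
                  (≤-trans len (+-monoʳ-≤ (length w) (∣⇒≤ {{>-nonZero e≥1}} d∣e)))
    a+a≤w = +-cancelʳ-≤ e (a + a) (length w) a+a+e≤w+e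
    a≤w = ≤-trans (m≤m+n a a) a+a≤w
    len′ : a + e ≤ length (take (length w ∸ a) w) + d
    len′ = begin
      a + e                   ≤⟨ m+n≤o⇒m≤o∸n (a + e) (subst (_≤ length w + d) (+-comm a (a + e)) len) ⟩
      length w + d ∸ a        ≡⟨ +-∸-comm d a≤w ⟩
      length w ∸ a + d        ≡⟨ cong (_+ d) (length-take-≤ (length w ∸ a) w (m∸n≤m (length w) a)) ⟨
      length (take (length w ∸ a) w) + d ∎
      where open ≤-Reasoning
    extend : CommonPeriod a e (take (length w ∸ a) w) → CommonPeriod a (a + e) w
    extend (g , g∣a , g∣e , period-g′) =
      g , g∣a , ∣m∣n⇒∣m+n g∣a g∣e , HasPeriod-extend w a≥1 a+a≤w g∣a period-a period-g′

  fine-wilf : ∀ {a b d} (w : List A) → 1 ≤ a → 1 ≤ b → d ∣ a → d ∣ b → a + b ≤ length w + d →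
              HasPeriod a w → HasPeriod b w → CommonPeriod a b w
  fine-wilf {a} {b} = euclid (<-wellFounded (a + b))
    where
    euclid : ∀ {a b d} → Acc _<_ (a + b) → (w : List A) → 1 ≤ a → 1 ≤ b → d ∣ a → d ∣ b →
             a + b ≤ length w + d → HasPeriod a w → HasPeriod b w → CommonPeriod a b w
    euclid {a} {b} rec w a≥1 b≥1 d∣a d∣b len period-a period-b with <-cmp a b
    ... | tri≈ _ refl _ = a , ∣-refl , ∣-refl , period-a
    euclid {a} {b} (acc smaller) w a≥1 b≥1 d∣a d∣b len period-a period-b | tri< a<b _ _
      with b ∸ a | m+[n∸m]≡n (<⇒≤ a<b)
    ... | e | refl = fine-wilf-step w a≥1 e≥1 d∣a d∣b len period-a period-b
          λ w′ d∣e len′ → euclid (smaller (m<n+m (a + e) a≥1)) w′ a≥1 e≥1 d∣a d∣e len′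
      where e≥1 = m<m+n⇒1≤n a<b
    euclid {a} {b} {d} (acc smaller) w a≥1 b≥1 d∣a d∣b len period-a period-b | tri> _ _ b<a
      with a ∸ b | m+[n∸m]≡n (<⇒≤ b<a)
    ... | e | refl = swap (fine-wilf-step w b≥1 e≥1 d∣b d∣a (subst (_≤ length w + d) (+-comm a b) len) period-b period-a
                       λ w′ d∣e len′ → euclid (smaller (m<m+n (b + e) b≥1)) w′ b≥1 e≥1 d∣b d∣e len′)
      where
      e≥1 = m<m+n⇒1≤n b<a
      swap : CommonPeriod b a w → CommonPeriod a b w
      swap (g , g∣b , g∣a , period-g) = g , g∣a , g∣b , period-g

  take-drop-period : ∀ {g} (w : List A) → g + g ≤ length w → HasPeriod g w → take g (drop g w) ≡ take g w
  take-drop-period {g} w g+g≤w period = at-extensional _ _ (trans |drop-prefix| (sym |prefix|)) same-at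
    where
    |drop-prefix| = length-take-≤ g (drop g w) (subst (g ≤_) (sym (length-drop g w)) (m+n≤o⇒m≤o∸n g g+g≤w))
    |prefix| = length-take-≤ g w (≤-trans (m≤m+n g g) g+g≤w)
    same-at : ∀ i → i < length (take g (drop g w)) → at (take g (drop g w)) i ≡ at (take g w) i
    same-at i i<| = begin
      at (take g (drop g w)) i ≡⟨ at-take g (drop g w) i<g ⟩
      at (drop g w) i          ≡⟨ at-drop g w i ⟩
      at w (g + i)             ≡⟨ cong (at w) (+-comm g i) ⟩
      at w (i + g)             ≡⟨ period i (<-≤-trans (+-monoˡ-< g i<g) g+g≤w) ⟨
      at w i                   ≡⟨ at-take g w i<g ⟨
      at (take g w) i          ∎
      where
      open ≡-Reasoning
      i<g = subst (i <_) |drop-prefix| i<|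

-- Arithmetic

3-prime : Prime 3
3-prime = from-yes (prime? 3)

3∣m*n⇒3∣n : ∀ m {n} → ¬ 3 ∣ m → 3 ∣ m * n → 3 ∣ n
3∣m*n⇒3∣n m 3∤m 3∣mn with euclidsLemma m _ 3-prime 3∣mn
... | inj₁ 3∣m = ⊥-elim (3∤m 3∣m)
... | inj₂ 3∣n = 3∣n

-- The shapes of a period p of a word of length L in which the Fine–Wilf bound holds for p and the
-- length of any proper root of the word; see common-divisor-bound.
PeriodFits : ℕ → ℕ → Set
PeriodFits p L = 2 * p ≤ L ⊎ ∃[ h ] (p ≡ 3 * h × L ≡ 4 * h)

-- d is gcd s p when p = 3h, L = 4h and k ∈ {2, 3}; otherwise d = 1 suffices.
common-divisor-bound : ∀ {L p k s} → 2 ≤ k → k * s ≡ L → PeriodFits p L →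
                       ∃[ d ] (d ∣ s × d ∣ p × s + p ≤ L + d)
common-divisor-bound {L} {p} {k} {s} 2≤k ks≡L (inj₁ 2p≤L) = 1 , 1∣ s , 1∣ p , ≤-trans s+p≤L (m≤m+n L 1)
  where
  2s≤L = ≤-trans (*-monoˡ-≤ s 2≤k) (≤-reflexive ks≡L)
  s+p≤L : s + p ≤ L
  s+p≤L = *-cancelˡ-≤ 2 (subst₂ _≤_ (sym (*-distribˡ-+ 2 s p)) (lemma L) (+-mono-≤ 2s≤L 2p≤L))
    where
    lemma : ∀ L → L + L ≡ 2 * L
    lemma = solve-∀
common-divisor-bound {k = suc zero} (s≤s ()) _ _
common-divisor-bound {k = 2} {s} _ 2s≡4h (inj₂ (h , refl , refl)) =
  h , divides 2 s≡2h , divides 3 refl , ≤-reflexive (trans (cong (_+ 3 * h) s≡2h) (lemma h))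
  where
  s≡2h : s ≡ 2 * h
  s≡2h = *-cancelˡ-≡ s (2 * h) 2 (trans 2s≡4h (*-assoc 2 2 h))
  lemma : ∀ h → 2 * h + 3 * h ≡ 4 * h + h
  lemma = solve-∀
common-divisor-bound {k = 3} {s} _ 3s≡4h (inj₂ (h , refl , refl))
  with divides e refl ← 3∣m*n⇒3∣n 4 {h} (from-no (3 ∣? 4)) (divides s (trans (sym 3s≡4h) (*-comm 3 s))) =
  e , divides 4 s≡4e , divides 9 (lemma₁ e) , ≤-reflexive (trans (cong (_+ 3 * (e * 3)) s≡4e) (lemma₂ e))
  where
  s≡4e : s ≡ 4 * e
  s≡4e = *-cancelˡ-≡ s (4 * e) 3 (trans 3s≡4h (lemma₀ e))
    where
    lemma₀ : ∀ e → 4 * (e * 3) ≡ 3 * (4 * e)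
    lemma₀ = solve-∀
  lemma₁ : ∀ e → 3 * (e * 3) ≡ 9 * e
  lemma₁ = solve-∀
  lemma₂ : ∀ e → 4 * e + 3 * (e * 3) ≡ 4 * (e * 3) + e
  lemma₂ = solve-∀
common-divisor-bound {k = suc (suc (suc (suc k)))} {s} _ ks≡4h (inj₂ (h , refl , refl)) =
  1 , 1∣ s , 1∣ (3 * h) , ≤-trans (+-monoˡ-≤ (3 * h) s≤h) (≤-trans (≤-reflexive (lemma h)) (m≤m+n (4 * h) 1))
  where
  s≤h : s ≤ h
  s≤h = *-cancelˡ-≤ 4 (≤-trans (*-monoˡ-≤ s (s≤s (s≤s (s≤s (s≤s (z≤n {k})))))) (≤-reflexive ks≡4h))
  lemma : ∀ h → h + 3 * h ≡ 4 * h
  lemma = solve-∀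

3*h∤root : ∀ {h k s} → 1 ≤ h → 2 ≤ k → k * s ≡ 4 * h → ¬ 3 * h ∣ s
3*h∤root {h} {k} {s} 1≤h 2≤k ks≡4h 3h∣s = <⇒≱ s<3h (∣⇒≤ {{≢-nonZero s≢0}} 3h∣s)
  where
  s≢0 : s ≢ 0
  s≢0 s≡0 = <⇒≱ (≤-trans 1≤h (m≤n*m h 4)) (≤-reflexive (trans (sym ks≡4h) (trans (cong (k *_) s≡0) (*-zeroʳ k))))
  s<3h : s < 3 * h
  s<3h = begin-strict
    s      ≤⟨ *-cancelˡ-≤ 2 (≤-trans (*-monoˡ-≤ s 2≤k) (≤-reflexive (trans ks≡4h (*-assoc 2 2 h)))) ⟩
    2 * h  <⟨ *-monoˡ-< h {{>-nonZero 1≤h}} (≤-refl {3}) ⟩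
    3 * h  ∎
    where open ≤-Reasoning

3*c∣s⇒3∣t : ∀ {c t k s} → 1 ≤ c → k * s ≡ 2 * (c * t) → 3 * c ∣ s → 3 ∣ t
3*c∣s⇒3∣t {suc c} {t} {k} (s≤s z≤n) ks≡2ct (divides a refl) =
  3∣m*n⇒3∣n 2 (from-no (3 ∣? 2)) (divides (k * a) (*-cancelʳ-≡ (2 * t) (k * a * 3) (suc c) 2tc≡3kac))
  where
  lemma₁ : ∀ c t → 2 * t * c ≡ 2 * (c * t)
  lemma₁ = solve-∀
  lemma₂ : ∀ k a c → k * (a * (3 * c)) ≡ k * a * 3 * c
  lemma₂ = solve-∀
  2tc≡3kac = trans (lemma₁ (suc c) t) (trans (sym ks≡2ct) (lemma₂ k a (suc c)))

PeriodFits-3*c : ∀ c t → 2 ≤ t → ¬ 3 ∣ t → PeriodFits (3 * c) (2 * (c * t))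
PeriodFits-3*c c 1 (s≤s ()) _
PeriodFits-3*c c 2 _ _ = inj₂ (c , refl , lemma c)
  where
  lemma : ∀ c → 2 * (c * 2) ≡ 4 * c
  lemma = solve-∀
PeriodFits-3*c c 3 _ 3∤3 = ⊥-elim (3∤3 (divides 1 refl))
PeriodFits-3*c c (suc (suc (suc (suc t)))) _ _ =
  inj₁ (*-monoʳ-≤ 2 (subst (_≤ c * (4 + t)) (*-comm c 3) (*-monoʳ-≤ c (s≤s (s≤s (s≤s (z≤n {suc t})))))))

c*t+3*c≤t*[3*c] : ∀ c t → 2 ≤ t → c * t + 3 * c ≤ t * (3 * c)
c*t+3*c≤t*[3*c] c 1 (s≤s ())
c*t+3*c≤t*[3*c] c (suc (suc t)) _ = subst (c * (2 + t) + 3 * c ≤_) (lemma c t) (m≤m+n _ (c + 2 * (c * t)))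
  where
  lemma : ∀ c t → c * (2 + t) + 3 * c + (c + 2 * (c * t)) ≡ (2 + t) * (3 * c)
  lemma = solve-∀

InΛ⁺-intro : ∀ {h c t} → h ≡ c * t → 2 ≤ t → ¬ 3 ∣ t → InΛ⁺ (2 * h) (2 * t)
InΛ⁺-intro {c = c} {t} refl 2≤t 3∤t =
  divides c (lemma c t) , (3∤t ∘ 3∣m*n⇒3∣n 2 (from-no (3 ∣? 2))) , *-monoʳ-≤ 2 2≤t , divides t (*-comm 2 t)
  where
  lemma : ∀ c t → 2 * (c * t) ≡ c * (2 * t)
  lemma = solve-∀

InΛ⁺-elim : ∀ {h d} → InΛ⁺ (2 * h) d → ∃[ c ] ∃[ t ] (d ≡ 2 * t × h ≡ c * t × 2 ≤ t × ¬ 3 ∣ t)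
InΛ⁺-elim {h} {d} (divides c 2h≡cd , 3∤d , 4≤d , divides t d≡t*2) =
  c , t , d≡2t , h≡ct , *-cancelˡ-≤ 2 (subst (4 ≤_) d≡2t 4≤d) , 3∤d ∘ subst (3 ∣_) (sym d≡t*2) ∘ ∣m⇒∣m*n 2
  where
  d≡2t = trans d≡t*2 (*-comm t 2)
  h≡ct : h ≡ c * t
  h≡ct = *-cancelˡ-≡ h (c * t) 2 (trans 2h≡cd (trans (cong (c *_) d≡2t) (lemma c t)))
    where
    lemma : ∀ c t → c * (2 * t) ≡ 2 * (c * t)
    lemma = solve-∀

Λ⁺-quotients : ∀ {h c t e} → suc e ≡ 2 * t → h ≡ c * t → suc e / 2 ≡ t × 3 * (2 * h) / suc e ≡ 3 * c
Λ⁺-quotients {h} {c} {t} {e} d≡2t refl =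
  trans (cong (_/ 2) (trans d≡2t (*-comm 2 t))) (m*n/n≡m t 2) ,
  trans (cong (_/ suc e) (trans (lemma c t) (cong (3 * c *_) (sym d≡2t)))) (m*n/n≡m (3 * c) (suc e))
  where
  lemma : ∀ c t → 3 * (2 * (c * t)) ≡ 3 * c * (2 * t)
  lemma = solve-∀

t*s≡3*h⇒s≡3*c : ∀ {h t s} → ¬ 3 ∣ t → t * s ≡ 3 * h → ∃[ c ] (s ≡ 3 * c × h ≡ c * t)
t*s≡3*h⇒s≡3*c {h} {t} {s} 3∤t ts≡3h with divides c refl ← 3∣m*n⇒3∣n t 3∤t (divides h (trans ts≡3h (*-comm 3 h))) =
  c , *-comm c 3 , *-cancelˡ-≡ h (c * t) 3 (trans (sym ts≡3h) (lemma t c))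
  where
  lemma : ∀ t c → t * (c * 3) ≡ 3 * (c * t)
  lemma = solve-∀

-- Powers and primitive words

module _ {n : ℕ} where

  length-^^ : ∀ (v : Word n) m → length (v ^^ m) ≡ m * length v
  length-^^ v zero    = refl
  length-^^ v (suc m) = trans (length-++ v) (cong (length v +_) (length-^^ v m))

  ^^-+ : ∀ (v : Word n) a b → v ^^ (a + b) ≡ v ^^ a ++ v ^^ b
  ^^-+ v zero    b = refl
  ^^-+ v (suc a) b = trans (cong (v ++_) (^^-+ v a b)) (sym (++-assoc v (v ^^ a) (v ^^ b)))

  ^^-* : ∀ (v : Word n) a b → (v ^^ a) ^^ b ≡ v ^^ (b * a)
  ^^-* v a zero    = refl
  ^^-* v a (suc b) = trans (cong (v ^^ a ++_) (^^-* v a b)) (sym (^^-+ v a (b * a)))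

  []-^^ : ∀ m → _^^_ {n} [] m ≡ []
  []-^^ zero    = refl
  []-^^ (suc m) = []-^^ m

  HasPeriod-^^ : ∀ (v : Word n) m → HasPeriod (length v) (v ^^ m)
  HasPeriod-^^ v zero    i ()
  HasPeriod-^^ v (suc m) i i+|v|< = begin
    at (v ^^ suc m) i            ≡⟨ cong (λ w → at w i) v^[1+m]≡v^m++v ⟩
    at (v ^^ m ++ v) i           ≡⟨ at-++ˡ (v ^^ m) v i<|v^m| ⟩
    at (v ^^ m) i                ≡⟨ at-++ʳ v (v ^^ m) i ⟨
    at (v ^^ suc m) (length v + i) ≡⟨ cong (at (v ^^ suc m)) (+-comm (length v) i) ⟩
    at (v ^^ suc m) (i + length v) ∎
    where
    open ≡-Reasoning
    v^[1+m]≡v^m++v : v ^^ suc m ≡ v ^^ m ++ v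
    v^[1+m]≡v^m++v = trans (cong (v ^^_) (+-comm 1 m)) (trans (^^-+ v m 1) (cong (v ^^ m ++_) (++-identityʳ v)))
    i<|v^m| : i < length (v ^^ m)
    i<|v^m| = +-cancelʳ-< (length v) i (length (v ^^ m))
                (subst (i + length v <_) (trans (length-++ v) (+-comm (length v) _)) i+|v|<)

  periodic⇒power : ∀ {g} m (w : Word n) → HasPeriod g w → length w ≡ m * g → w ≡ take g w ^^ m
  periodic⇒power zero [] _ _ = refl
  periodic⇒power {g} (suc zero) w _ |w|≡g =
    sym (trans (++-identityʳ (take g w)) (take-all g w (≤-reflexive (trans |w|≡g (+-identityʳ g)))))
  periodic⇒power {g} (suc (suc m)) w period |w|≡ = begin
    w                                      ≡⟨ take++drop≡id g w ⟨
    take g w ++ drop g w                   ≡⟨ cong (take g w ++_)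
                                                (periodic⇒power (suc m) (drop g w) (HasPeriod-drop g w period) |drop|≡) ⟩
    take g w ++ take g (drop g w) ^^ suc m ≡⟨ cong (λ u → take g w ++ u ^^ suc m) (take-drop-period w g+g≤w period) ⟩
    take g w ^^ suc (suc m)                ∎
    where
    open ≡-Reasoning
    |drop|≡ : length (drop g w) ≡ suc m * g
    |drop|≡ = trans (length-drop g w) (trans (cong (_∸ g) |w|≡) (m+n∸m≡n g (suc m * g)))
    g+g≤w : g + g ≤ length w
    g+g≤w = subst (g + g ≤_) (sym |w|≡) (+-monoʳ-≤ g (m≤m+n g (m * g)))

  Primitive⇒1≤length : ∀ {u : Word n} → Primitive u → 1 ≤ length u
  Primitive⇒1≤length {[]}    (u≢[] , _) = ⊥-elim (u≢[] refl)
  Primitive⇒1≤length {_ ∷ _} _          = s≤s z≤n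

  primitive-intro : ∀ {u : Word n} → u ≢ [] → (∀ v m → 2 ≤ m → u ≢ v ^^ m) → Primitive u
  primitive-intro u≢[] no-power = u≢[] , λ where
    v (suc zero)    _ _       → refl
    v (suc (suc m)) _ u≡v^m → ⊥-elim (no-power v (suc (suc m)) (s≤s (s≤s z≤n)) u≡v^m)

  ¬Primitive-^^ : ∀ (v : Word n) {m} → 2 ≤ m → ¬ Primitive (v ^^ m)
  ¬Primitive-^^ v {m} 2≤m (_ , only-trivial) with only-trivial v m (≤-trans (s≤s z≤n) 2≤m) refl
  ... | refl with s≤s () ← 2≤m

  ¬Primitive-periodic : ∀ {g m} (w : Word n) → HasPeriod g w → length w ≡ m * g → 2 ≤ m → ¬ Primitive w
  ¬Primitive-periodic {g} {m} w period |w|≡mg 2≤m =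
    subst (λ u → ¬ Primitive u) (sym (periodic⇒power m w period |w|≡mg)) (¬Primitive-^^ (take g w) 2≤m)

  primitive-period-divisor : ∀ {g} {u : Word n} → Primitive u → HasPeriod g u → g ∣ length u → g ≡ length u
  primitive-period-divisor {g} {u} prim period g∣u with g ≟ length u
  ... | yes g≡u = g≡u
  ... | no  g≢u = ⊥-elim (¬Primitive-periodic u period (_∣_.equality g∣u)
                            (quotient>1 g∣u (≤∧≢⇒< (∣⇒≤ {{>-nonZero (Primitive⇒1≤length prim)}} g∣u) g≢u)) prim)

  ProperPower : Word n → Set
  ProperPower u = ∃[ v ] ∃[ m ] (2 ≤ m × u ≡ v ^^ m)

  -- A nonempty u ≡ v ^^ m has |v| ≤ |u| and m ≤ |u|, so being a proper power is a finite search.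
  private
    BoundedPower : Word n → Set
    BoundedPower u = ∃[ d ] ∃[ m ] (2 ≤ toℕ m × u ≡ take (toℕ {suc (length u)} d) u ^^ toℕ {suc (length u)} m)

    bounded-power? : (u : Word n) → Dec (BoundedPower u)
    bounded-power? u = any? (λ d → any? (λ m → (2 ≤? toℕ m) ×-dec (≡-dec Fin._≟_ u (take (toℕ d) u ^^ toℕ m))))

    bounded : ∀ {u} d m → d < suc (length u) → m < suc (length u) → 2 ≤ m → u ≡ take d u ^^ m → BoundedPower u
    bounded {u} d m d< m< 2≤m u≡ =
      fromℕ< d< , fromℕ< m< , subst (2 ≤_) (sym (toℕ-fromℕ< m<)) 2≤m ,
      subst₂ (λ d m → u ≡ take d u ^^ m) (sym (toℕ-fromℕ< d<)) (sym (toℕ-fromℕ< m<)) u≡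

    ProperPower⇒BoundedPower : ∀ {u} → u ≢ [] → ProperPower u → BoundedPower u
    ProperPower⇒BoundedPower u≢[] ([] , m , 2≤m , u≡[]^m) = ⊥-elim (u≢[] (trans u≡[]^m ([]-^^ m)))
    ProperPower⇒BoundedPower {u} _ (v@(_ ∷ _) , m@(suc m′) , 2≤m , u≡v^m) =
      bounded (length v) m (s≤s (subst (length v ≤_) (sym |u|≡) (m≤n*m (length v) m)))
        (s≤s (subst (m ≤_) (sym |u|≡) (m≤m*n m (length v))))
        2≤m (trans u≡v^m (cong (_^^ m) (sym prefix)))
      where
      |u|≡ = trans (cong length u≡v^m) (length-^^ v m)
      prefix : take (length v) u ≡ v
      prefix = trans (cong (take (length v)) u≡v^m) (take-length-++ v (v ^^ m′))

  proper-power? : (u : Word n) → u ≢ [] → Dec (ProperPower u)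
  proper-power? u u≢[] with bounded-power? u
  ... | yes (d , m , 2≤m , u≡) = yes (take (toℕ d) u , toℕ m , 2≤m , u≡)
  ... | no ¬bounded = no (¬bounded ∘ ProperPower⇒BoundedPower u≢[])

  primitive? : (u : Word n) → Dec (Primitive u)
  primitive? []        = no λ (u≢[] , _) → u≢[] refl
  primitive? u@(_ ∷ _) with proper-power? u (λ ())
  ... | yes (v , m , 2≤m , u≡v^m) = no (subst (λ u → ¬ Primitive u) (sym u≡v^m) (¬Primitive-^^ v 2≤m))
  ... | no ¬power = yes (primitive-intro (λ ()) λ v m 2≤m u≡v^m → ¬power (v , m , 2≤m , u≡v^m))

  ¬Primitive⇒ProperPower : ∀ {u : Word n} → u ≢ [] → ¬ Primitive u → ProperPower u
  ¬Primitive⇒ProperPower {u} u≢[] ¬prim with proper-power? u u≢[]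
  ... | yes power = power
  ... | no ¬power = ⊥-elim (¬prim (primitive-intro u≢[] λ v m 2≤m u≡v^m → ¬power (v , m , 2≤m , u≡v^m)))

  length-<-^^ : ∀ (v : Word n) {m} → 1 ≤ length v → 2 ≤ m → length v < length (v ^^ m)
  length-<-^^ v {m} 1≤|v| 2≤m = begin-strict
    length v               <⟨ m<m+n (length v) 1≤|v| ⟩
    length v + length v    ≡⟨ cong (length v +_) (+-identityʳ (length v)) ⟨
    2 * length v           ≤⟨ *-monoˡ-≤ (length v) 2≤m ⟩
    m * length v           ≡⟨ length-^^ v m ⟨
    length (v ^^ m)        ∎
    where open ≤-Reasoning

  ¬Primitive⇒power-of-primitive : ∀ {u : Word n} → u ≢ [] → ¬ Primitive u →
                                   ∃[ v ] ∃[ t ] (Primitive v × 2 ≤ t × u ≡ v ^^ t)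
  ¬Primitive⇒power-of-primitive {u} = go (<-wellFounded (length u))
    where
    go : ∀ {u : Word n} → Acc _<_ (length u) → u ≢ [] → ¬ Primitive u →
         ∃[ v ] ∃[ t ] (Primitive v × 2 ≤ t × u ≡ v ^^ t)
    go {u} (acc shorter) u≢[] ¬prim with ¬Primitive⇒ProperPower u≢[] ¬prim
    ... | [] , m , _ , u≡[]^m = ⊥-elim (u≢[] (trans u≡[]^m ([]-^^ m)))
    ... | v@(_ ∷ _) , m@(suc _) , 2≤m , u≡v^m with primitive? v
    ...   | yes prim-v = v , m , prim-v , 2≤m , u≡v^m
    ...   | no ¬prim-v
      with w , j , prim-w , 2≤j , v≡w^j ←
             go (shorter (subst (λ u → length v < length u) (sym u≡v^m) (length-<-^^ v (s≤s z≤n) 2≤m))) (λ ()) ¬prim-v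
      = w , m * j , prim-w , ≤-trans 2≤j (m≤n*m j m) , trans u≡v^m (trans (cong (_^^ m) v≡w^j) (^^-* w j m))

  Primitive-rotate : ∀ (a b : Word n) → Primitive (a ++ b) → Primitive (b ++ a)
  Primitive-rotate a b prim = primitive-intro b++a≢[] no-power
    where
    |ab|≡|ba| : length (a ++ b) ≡ length (b ++ a)
    |ab|≡|ba| = trans (length-++ a) (trans (+-comm (length a) (length b)) (sym (length-++ b)))
    b++a≢[] : b ++ a ≢ []
    b++a≢[] b++a≡[] with () ← subst (1 ≤_) (trans |ab|≡|ba| (cong length b++a≡[])) (Primitive⇒1≤length prim)
    factor : take (length (a ++ b)) (drop (length b) ((b ++ a) ++ (b ++ a))) ≡ a ++ b
    factor = begin
      take ℓ (drop (length b) ((b ++ a) ++ (b ++ a))) ≡⟨ cong (take ℓ ∘ drop (length b)) (++-assoc b a (b ++ a)) ⟩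
      take ℓ (drop (length b) (b ++ (a ++ (b ++ a)))) ≡⟨ cong (take ℓ) (drop-length-++ b _) ⟩
      take ℓ (a ++ (b ++ a))                           ≡⟨ cong (take ℓ) (++-assoc a b a) ⟨
      take ℓ ((a ++ b) ++ a)                           ≡⟨ take-length-++ (a ++ b) a ⟩
      a ++ b                                           ∎
      where
      open ≡-Reasoning
      ℓ = length (a ++ b)
    no-power : ∀ v m → 2 ≤ m → b ++ a ≢ v ^^ m
    no-power v m 2≤m b++a≡v^m = ¬Primitive-periodic (a ++ b) period |ab|≡m|v| 2≤m prim
      where
      square : (b ++ a) ++ (b ++ a) ≡ v ^^ (m + m)
      square = trans (cong₂ _++_ b++a≡v^m b++a≡v^m) (sym (^^-+ v m m))
      period : HasPeriod (length v) (a ++ b)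
      period = subst (HasPeriod (length v)) factor
                 (HasPeriod-take (length (a ++ b)) _ (HasPeriod-drop (length b) ((b ++ a) ++ (b ++ a))
                   (subst (HasPeriod (length v)) (sym square) (HasPeriod-^^ v (m + m)))))
      |ab|≡m|v| = trans |ab|≡|ba| (trans (cong length b++a≡v^m) (length-^^ v m))

  Primitive-factor-^^ : ∀ (v : Word n) t a → Primitive v → a + length v ≤ t * length v →
                        Primitive (take (length v) (drop a (v ^^ t)))
  Primitive-factor-^^ v zero a prim bound with () ← ≤-trans (Primitive⇒1≤length prim) (≤-trans (m≤n+m (length v) a) bound)
  Primitive-factor-^^ v (suc t) zero prim _ = subst Primitive (sym (take-length-++ v (v ^^ t))) prim
  Primitive-factor-^^ v (suc t) a@(suc _) prim bound with length v ≤? a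
  ... | yes |v|≤a = subst (λ w → Primitive (take (length v) w)) (sym (drop-++-≥ a v (v ^^ t) |v|≤a))
                      (Primitive-factor-^^ v t (a ∸ length v) prim bound′)
    where
    shift : a + length v ≡ length v + (a ∸ length v + length v)
    shift = trans (cong (_+ length v) (sym (m+[n∸m]≡n |v|≤a))) (+-assoc (length v) (a ∸ length v) (length v))
    bound′ = +-cancelˡ-≤ (length v) _ _ (subst (_≤ suc t * length v) shift bound)
  ... | no |v|≰a with t
  ...   | zero = ⊥-elim (<⇒≱ (m<n+m (length v) (s≤s z≤n)) (subst (a + length v ≤_) (+-identityʳ (length v)) bound))
  ...   | suc t′ = subst Primitive (sym rotation) (Primitive-rotate z y (subst Primitive (sym (take++drop≡id a v)) prim))
    where
    z = take a v
    y = drop a v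
    r = v ^^ t′
    |v|≡ : length v ≡ length (y ++ z)
    |v|≡ = trans (cong length (sym (take++drop≡id a v))) (trans (length-++ z) (trans (+-comm (length z) _) (sym (length-++ y))))
    rotation : take (length v) (drop a (v ++ (v ++ r))) ≡ y ++ z
    rotation = begin
      take (length v) (drop a (v ++ (v ++ r)))     ≡⟨ cong (take (length v)) (drop-++-≤ a v (v ++ r) (<⇒≤ (≰⇒> |v|≰a))) ⟩
      take (length v) (y ++ (v ++ r))              ≡⟨ cong (λ u → take (length v) (y ++ (u ++ r))) (take++drop≡id a v) ⟨
      take (length v) (y ++ ((z ++ y) ++ r))       ≡⟨ cong (λ u → take (length v) (y ++ u)) (++-assoc z y r) ⟩
      take (length v) (y ++ (z ++ (y ++ r)))       ≡⟨ cong (take (length v)) (++-assoc y z (y ++ r)) ⟨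
      take (length v) ((y ++ z) ++ (y ++ r))       ≡⟨ cong (λ k → take k ((y ++ z) ++ (y ++ r))) |v|≡ ⟩
      take (length (y ++ z)) ((y ++ z) ++ (y ++ r)) ≡⟨ take-length-++ (y ++ z) (y ++ r) ⟩
      y ++ z                                       ∎
      where open ≡-Reasoning

  primitive-prefix-period : ∀ {p s d} (f : Word n) → Primitive (take p f) → p ≤ length f →
                            HasPeriod p f → HasPeriod s f → 1 ≤ s → d ∣ s → d ∣ p → s + p ≤ length f + d → p ∣ s
  primitive-prefix-period {p} {s} f prim-prefix p≤f period-p period-s 1≤s d∣s d∣p bound =
    prefix-is-common (fine-wilf f 1≤s 1≤p d∣s d∣p bound period-s period-p)
    where
    |prefix|≡p = length-take-≤ p f p≤f
    1≤p = subst (1 ≤_) |prefix|≡p (Primitive⇒1≤length prim-prefix)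
    prefix-is-common : CommonPeriod s p f → p ∣ s
    prefix-is-common (g , g∣s , g∣p , period-g) =
      subst (_∣ s) (trans g≡|prefix| |prefix|≡p) g∣s
      where
      g≡|prefix| = primitive-period-divisor prim-prefix (HasPeriod-take p f period-g) (subst (g ∣_) (sym |prefix|≡p) g∣p)

  primitive-period-∣-root : ∀ {p k} (f u : Word n) → Primitive (take p f) → HasPeriod p f → f ≡ u ^^ k → 2 ≤ k →
                            PeriodFits p (length f) → p ∣ length u
  primitive-period-∣-root {p} {k} f u prim-prefix period-p f≡u^k 2≤k shape =
    root-is-multiple (common-divisor-bound 2≤k (sym |f|≡k|u|) shape)
    where
    |f|≡k|u| = trans (cong length f≡u^k) (length-^^ u k)
    p≤f : p ≤ length f
    p≤f = [ (λ 2p≤f → ≤-trans (m≤m+n p (p + 0)) 2p≤f)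
          , (λ (h , p≡3h , |f|≡4h) → subst₂ _≤_ (sym p≡3h) (sym |f|≡4h) (*-monoˡ-≤ h {3} {4} (s≤s (s≤s (s≤s z≤n))))) ]′ shape
    1≤p = subst (1 ≤_) (length-take-≤ p f p≤f) (Primitive⇒1≤length prim-prefix)
    1≤|u| : 1 ≤ length u
    1≤|u| = n≢0⇒n>0 λ |u|≡0 → <⇒≱ (≤-trans 1≤p p≤f) (≤-reflexive (trans |f|≡k|u| (trans (cong (k *_) |u|≡0) (*-zeroʳ k))))
    root-is-multiple : ∃[ d ] (d ∣ length u × d ∣ p × length u + p ≤ length f + d) → p ∣ length u
    root-is-multiple (d , d∣u , d∣p , bound) =
      primitive-prefix-period f prim-prefix p≤f period-p (subst (HasPeriod (length u)) (sym f≡u^k) (HasPeriod-^^ u k))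
        1≤|u| d∣u d∣p bound

  ^^-cancelʳ : ∀ (v w : Word n) {m} → 1 ≤ m → v ^^ m ≡ w ^^ m → v ≡ w
  ^^-cancelʳ v w {suc k} _ v^k≡w^k = begin
    v                            ≡⟨ take-length-++ v (v ^^ k) ⟨
    take (length v) (v ^^ suc k) ≡⟨ cong₂ take |v|≡|w| v^k≡w^k ⟩
    take (length w) (w ^^ suc k) ≡⟨ take-length-++ w (w ^^ k) ⟩
    w                            ∎
    where
    open ≡-Reasoning
    |v|≡|w| = *-cancelˡ-≡ (length v) (length w) (suc k)
                (trans (sym (length-^^ v (suc k))) (trans (cong length v^k≡w^k) (length-^^ w (suc k))))

  ^^-exponent-unique : ∀ {v w : Word n} {t s} → Primitive v → Primitive w → 2 ≤ t → 2 ≤ s → v ^^ t ≡ w ^^ s → t ≡ s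
  ^^-exponent-unique {v} {w} {t} {s} prim-v prim-w 2≤t 2≤s v^t≡w^s =
    *-cancelʳ-≡ t s (length v) {{>-nonZero (Primitive⇒1≤length prim-v)}}
      (trans (sym (length-^^ v t)) (trans (cong length v^t≡w^s) (trans (length-^^ w s) (cong (s *_) (sym |v|≡|w|)))))
    where
    root-∣ : ∀ {u u′ : Word n} {a b} → Primitive u → 2 ≤ a → 2 ≤ b → u ^^ a ≡ u′ ^^ b → length u ∣ length u′
    root-∣ {u} {u′} {a@(suc a′)} prim 2≤a 2≤b u^a≡u′^b =
      primitive-period-∣-root (u ^^ a) u′ (subst Primitive (sym (take-length-++ u (u ^^ a′))) prim)
        (HasPeriod-^^ u a) u^a≡u′^b 2≤b (inj₁ (subst (2 * length u ≤_) (sym (length-^^ u a)) (*-monoˡ-≤ (length u) 2≤a)))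
    |v|≡|w| = ∣-antisym (root-∣ prim-v 2≤t 2≤s v^t≡w^s) (root-∣ prim-w 2≤s 2≤t (sym v^t≡w^s))

  Primitive-++-prefix : ∀ (x q : Word n) → length q ≡ 2 * length x → Primitive (x ++ q) → Primitive (x ++ q ++ x)
  Primitive-++-prefix x q |q|≡2h prim = primitive-intro xqx≢[] no-power
    where
    h = length x
    |xq|≡3h : length (x ++ q) ≡ 3 * h
    |xq|≡3h = trans (length-++ x) (trans (cong (h +_) |q|≡2h) (lemma h))
      where
      lemma : ∀ h → h + 2 * h ≡ 3 * h
      lemma = solve-∀
    |xqx|≡4h : length (x ++ q ++ x) ≡ 4 * h
    |xqx|≡4h =
      trans (cong length (sym (++-assoc x q x))) (trans (length-++ (x ++ q)) (trans (cong (_+ h) |xq|≡3h) (lemma h)))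
      where
      lemma : ∀ h → 3 * h + h ≡ 4 * h
      lemma = solve-∀
    1≤h : 1 ≤ h
    1≤h = n≢0⇒n>0 λ h≡0 → <⇒≱ (Primitive⇒1≤length prim) (≤-reflexive (trans |xq|≡3h (trans (cong (3 *_) h≡0) (*-zeroʳ 3))))
    xqx≢[] : x ++ q ++ x ≢ []
    xqx≢[] xqx≡[] with () ← subst (1 ≤_) (trans (sym |xqx|≡4h) (cong length xqx≡[])) (≤-trans 1≤h (m≤n*m h 4))
    prefix : take (3 * h) (x ++ q ++ x) ≡ x ++ q
    prefix = trans (cong₂ take (sym |xq|≡3h) (sym (++-assoc x q x))) (take-length-++ (x ++ q) x)
    period-3h : HasPeriod (3 * h) (x ++ q ++ x)
    period-3h = subst (λ p → HasPeriod p (x ++ q ++ x)) |xq|≡3h (HasPeriod-border x q)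
    no-power : ∀ u k → 2 ≤ k → x ++ q ++ x ≢ u ^^ k
    no-power u k 2≤k xqx≡u^k =
      3*h∤root 1≤h 2≤k (trans (sym (length-^^ u k)) (trans (cong length (sym xqx≡u^k)) |xqx|≡4h))
        (primitive-period-∣-root (x ++ q ++ x) u (subst Primitive (sym prefix) prim) period-3h xqx≡u^k 2≤k
          (inj₂ (h , refl , |xqx|≡4h)))

  length-^^-3* : ∀ (v : Word n) c t → length v ≡ 3 * c → length (v ^^ t) ≡ c * t + 2 * (c * t)
  length-^^-3* v c t |v|≡3c = trans (length-^^ v t) (trans (cong (t *_) |v|≡3c) (lemma c t))
    where
    lemma : ∀ c t → t * (3 * c) ≡ c * t + 2 * (c * t)
    lemma = solve-∀

  length-drop-^^-3* : ∀ (v : Word n) c t → length v ≡ 3 * c → length (drop (c * t) (v ^^ t)) ≡ 2 * (c * t)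
  length-drop-^^-3* v c t |v|≡3c =
    trans (length-drop (c * t) (v ^^ t)) (trans (cong (_∸ c * t) (length-^^-3* v c t |v|≡3c)) (m+n∸m≡n (c * t) _))

  -- The prefix of length 3c is a conjugate of v; a proper root of the word would therefore have length a
  -- multiple of 3c, forcing 3 ∣ t.
  Primitive-drop-^^ : ∀ (v : Word n) {c t} → Primitive v → length v ≡ 3 * c → 2 ≤ t → ¬ 3 ∣ t →
                      Primitive (drop (c * t) (v ^^ t))
  Primitive-drop-^^ v {c} {t} prim |v|≡3c 2≤t 3∤t = primitive-intro q≢[] no-power
    where
    q = drop (c * t) (v ^^ t)
    1≤c : 1 ≤ c
    1≤c = n≢0⇒n>0 λ c≡0 → <⇒≱ (Primitive⇒1≤length prim) (≤-reflexive (trans |v|≡3c (trans (cong (3 *_) c≡0) (*-zeroʳ 3))))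
    |q|≡2ct = length-drop-^^-3* v c t |v|≡3c
    q≢[] : q ≢ []
    q≢[] q≡[] = <⇒≱ (≤-trans (≤-trans 1≤c (m≤m*n c t {{>-nonZero (≤-trans (s≤s z≤n) 2≤t)}})) (m≤m+n (c * t) _))
                    (≤-reflexive (trans (sym |q|≡2ct) (cong length q≡[])))
    prefix-primitive : Primitive (take (3 * c) q)
    prefix-primitive = subst (λ p → Primitive (take p q)) |v|≡3c
      (Primitive-factor-^^ v t (c * t) prim (subst (λ p → c * t + p ≤ t * p) (sym |v|≡3c) (c*t+3*c≤t*[3*c] c t 2≤t)))
    period-3c : HasPeriod (3 * c) q
    period-3c = subst (λ p → HasPeriod p q) |v|≡3c (HasPeriod-drop (c * t) (v ^^ t) (HasPeriod-^^ v t))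
    no-power : ∀ u k → 2 ≤ k → q ≢ u ^^ k
    no-power u k 2≤k q≡u^k =
      3∤t (3*c∣s⇒3∣t {k = k} 1≤c (trans (sym (length-^^ u k)) (trans (cong length (sym q≡u^k)) |q|≡2ct))
        (primitive-period-∣-root q u prefix-primitive period-3c q≡u^k 2≤k
          (subst (PeriodFits (3 * c)) (sym |q|≡2ct) (PeriodFits-3*c c t 2≤t 3∤t))))

  ¬3∣exponent : ∀ (x q v : Word n) {t} → length q ≡ 2 * length x → Primitive q → x ++ q ≡ v ^^ t → ¬ 3 ∣ t
  ¬3∣exponent x q v |q|≡2|x| prim-q xq≡v^t (divides m refl) = ¬Primitive-v^2m m (subst Primitive q≡v^2m prim-q)
    where
    ¬Primitive-v^2m : ∀ m → ¬ Primitive (v ^^ (m * 2))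
    ¬Primitive-v^2m zero    (nonempty , _) = nonempty refl
    ¬Primitive-v^2m (suc m) = ¬Primitive-^^ v {suc m * 2} (s≤s (s≤s z≤n))
    3|x|≡3m|v| : 3 * length x ≡ 3 * (m * length v)
    3|x|≡3m|v| = begin
      3 * length x             ≡⟨ lemma₁ (length x) ⟩
      length x + 2 * length x  ≡⟨ cong (length x +_) |q|≡2|x| ⟨
      length x + length q      ≡⟨ length-++ x ⟨
      length (x ++ q)          ≡⟨ cong length xq≡v^t ⟩
      length (v ^^ (m * 3))    ≡⟨ length-^^ v (m * 3) ⟩
      m * 3 * length v         ≡⟨ lemma₂ m (length v) ⟩
      3 * (m * length v)       ∎
      where
      open ≡-Reasoning
      lemma₁ : ∀ a → 3 * a ≡ a + 2 * a
      lemma₁ = solve-∀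
      lemma₂ : ∀ m a → m * 3 * a ≡ 3 * (m * a)
      lemma₂ = solve-∀
    |x|≡|v^m| : length x ≡ length (v ^^ m)
    |x|≡|v^m| = trans (*-cancelˡ-≡ _ _ 3 3|x|≡3m|v|) (sym (length-^^ v m))
    q≡v^2m : q ≡ v ^^ (m * 2)
    q≡v^2m = begin
      q                                               ≡⟨ drop-length-++ x q ⟨
      drop (length x) (x ++ q)                        ≡⟨ cong₂ drop |x|≡|v^m| xq≡v^t ⟩
      drop (length (v ^^ m)) (v ^^ (m * 3))           ≡⟨ cong (drop (length (v ^^ m)) ∘ (v ^^_)) (lemma m) ⟩
      drop (length (v ^^ m)) (v ^^ (m + m * 2))       ≡⟨ cong (drop (length (v ^^ m))) (^^-+ v m (m * 2)) ⟩
      drop (length (v ^^ m)) (v ^^ m ++ v ^^ (m * 2)) ≡⟨ drop-length-++ (v ^^ m) _ ⟩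
      v ^^ (m * 2)                                    ∎
      where
      open ≡-Reasoning
      lemma : ∀ m → m * 3 ≡ m + m * 2
      lemma = solve-∀

  attach : Word n × Word n → Word n × Word n
  attach (x , q) = x ++ q ++ x , q

  attach-injective : ∀ {z z′} → attach z ≡ attach z′ → z ≡ z′
  attach-injective {x , q} {x′ , q′} eq with refl ← cong proj₂ eq = cong (_, q) (begin
    x                        ≡⟨ take-length-++ x (q ++ x) ⟨
    take (length x) (x ++ q ++ x)    ≡⟨ cong₂ take |x|≡|x′| (cong proj₁ eq) ⟩
    take (length x′) (x′ ++ q ++ x′) ≡⟨ take-length-++ x′ (q ++ x′) ⟩
    x′                       ∎)
    where
    open ≡-Reasoning
    length-attach : ∀ y → length (y ++ q ++ y) ≡ length q + 2 * length y
    length-attach y = trans (length-++ y) (trans (cong (length y +_) (length-++ q)) (lemma (length y) (length q)))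
      where
      lemma : ∀ a b → a + (b + a) ≡ b + 2 * a
      lemma = solve-∀
    |x|≡|x′| = *-cancelˡ-≡ (length x) (length x′) 2 (+-cancelˡ-≡ (length q) _ _
                 (trans (sym (length-attach x)) (trans (cong (length ∘ proj₁) eq) (length-attach x′))))

-- The pairs counted by ε₁

module _ {n : ℕ} (h : ℕ) where

  PrefixPair : Word n × Word n → Set
  PrefixPair z = length (proj₁ z) ≡ h × PrimOfLength n (2 * h) (proj₂ z)

  -- Cut e z: z is v ^^ (d / 2) cut at h, for d = suc e ∈ Λ⁺(2h) and v primitive of length 3·2h/d.
  -- Indexing by e = d - 1 matches the summation in Λ⁺Sum.
  Cut : ℕ → Word n × Word n → Set
  Cut e z = InΛ⁺ (2 * h) (suc e) × ∃[ v ] (PrimOfLength n (3 * (2 * h) / suc e) v × z ≡ splitAt h (v ^^ (suc e / 2)))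

  Cut-disjoint : ∀ {e e′ z} → Cut e z → Cut e′ z → e ≡ e′
  Cut-disjoint {e} {e′} (inΛ , v , (_ , prim-v) , z≡) (inΛ′ , v′ , (_ , prim-v′) , z≡′)
    with c , t , d≡2t , h≡ct , 2≤t , _ ← InΛ⁺-elim inΛ
       | c′ , t′ , d′≡2t′ , h≡c′t′ , 2≤t′ , _ ← InΛ⁺-elim inΛ′ =
    suc-injective (trans d≡2t (trans (cong (2 *_) t≡t′) (sym d′≡2t′)))
    where
    t≡t′ = ^^-exponent-unique prim-v prim-v′ 2≤t 2≤t′ (splitAt-injective h (begin
      splitAt h (v ^^ t)             ≡⟨ cong (λ m → splitAt h (v ^^ m)) (proj₁ (Λ⁺-quotients {h} {c} d≡2t h≡ct)) ⟨
      splitAt h (v ^^ (suc e / 2))   ≡⟨ trans (sym z≡) z≡′ ⟩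
      splitAt h (v′ ^^ (suc e′ / 2)) ≡⟨ cong (λ m → splitAt h (v′ ^^ m)) (proj₁ (Λ⁺-quotients {h} {c′} d′≡2t′ h≡c′t′)) ⟩
      splitAt h (v′ ^^ t′)           ∎))
      where open ≡-Reasoning

  Cut-intro : ∀ {c t} (v : Word n) → Primitive v → length v ≡ 3 * c → h ≡ c * t → 2 ≤ t → ¬ 3 ∣ t →
              Cut (pred (2 * t)) (splitAt h (v ^^ t))
  Cut-intro {c} {suc t} v prim |v|≡3c h≡ct 2≤t 3∤t =
    InΛ⁺-intro {c = c} h≡ct 2≤t 3∤t , v , (trans |v|≡3c (sym (proj₂ quotients)) , prim) ,
    cong (λ m → splitAt h (v ^^ m)) (sym (proj₁ quotients))
    where quotients = Λ⁺-quotients {h} {c} refl h≡ct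

  NonPrimitivePair : Word n × Word n → Set
  NonPrimitivePair z = PrefixPair z × ¬ Primitive (proj₁ z ++ proj₂ z)

  NonPrimitivePair-splitAt : ∀ {c t} (v : Word n) → Primitive v → length v ≡ 3 * c → h ≡ c * t → 2 ≤ t → ¬ 3 ∣ t →
                             NonPrimitivePair (splitAt h (v ^^ t))
  NonPrimitivePair-splitAt {c} {t} v prim |v|≡3c refl 2≤t 3∤t rewrite splitAt-defn (c * t) (v ^^ t) =
    (length-take-≤ (c * t) (v ^^ t) ct≤|v^t| , length-drop-^^-3* v c t |v|≡3c ,
     Primitive-drop-^^ v {c} prim |v|≡3c 2≤t 3∤t) ,
    subst (λ w → ¬ Primitive w) (sym (take++drop≡id (c * t) (v ^^ t))) (¬Primitive-^^ v 2≤t)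
    where
    ct≤|v^t| : c * t ≤ length (v ^^ t)
    ct≤|v^t| = subst (c * t ≤_) (sym (length-^^-3* v c t |v|≡3c)) (m≤m+n (c * t) _)

  power⇒Cut : ∀ {x q v t} → PrefixPair (x , q) → Primitive v → 2 ≤ t → x ++ q ≡ v ^^ t →
              ∃[ e ] (e ∈ upTo (2 * h) × Cut e (x , q))
  power⇒Cut {x} {q} {v} {t} (|x|≡h , |q|≡2h , prim-q) prim-v 2≤t xq≡v^t = cut (t*s≡3*h⇒s≡3*c 3∤t t|v|≡3h)
    where
    3∤t = ¬3∣exponent x q v (trans |q|≡2h (cong (2 *_) (sym |x|≡h))) prim-q xq≡v^t
    t|v|≡3h : t * length v ≡ 3 * h
    t|v|≡3h = begin
      t * length v      ≡⟨ length-^^ v t ⟨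
      length (v ^^ t)   ≡⟨ cong length xq≡v^t ⟨
      length (x ++ q)   ≡⟨ length-++ x ⟩
      length x + length q ≡⟨ cong₂ _+_ |x|≡h |q|≡2h ⟩
      h + 2 * h         ≡⟨ lemma h ⟩
      3 * h             ∎
      where
      open ≡-Reasoning
      lemma : ∀ h → h + 2 * h ≡ 3 * h
      lemma = solve-∀
    split≡ : splitAt h (v ^^ t) ≡ (x , q)
    split≡ = begin
      splitAt h (v ^^ t)          ≡⟨ cong (splitAt h) xq≡v^t ⟨
      splitAt h (x ++ q)          ≡⟨ splitAt-defn h (x ++ q) ⟩
      (take h (x ++ q) , drop h (x ++ q)) ≡⟨ cong (λ k → take k (x ++ q) , drop k (x ++ q)) |x|≡h ⟨
      (take (length x) (x ++ q) , drop (length x) (x ++ q)) ≡⟨ cong₂ _,_ (take-length-++ x q) (drop-length-++ x q) ⟩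
      (x , q)                     ∎
      where open ≡-Reasoning
    cut : ∃[ c ] (length v ≡ 3 * c × h ≡ c * t) → ∃[ e ] (e ∈ upTo (2 * h) × Cut e (x , q))
    cut (c , |v|≡3c , h≡ct) =
      pred (2 * t) , ∈-upTo⁺ e<2h , subst (Cut (pred (2 * t))) split≡ (Cut-intro {c} v prim-v |v|≡3c h≡ct 2≤t 3∤t)
      where
      1≤c : 1 ≤ c
      1≤c = n≢0⇒n>0 λ c≡0 → <⇒≱ (Primitive⇒1≤length prim-v) (≤-reflexive (trans |v|≡3c (cong (3 *_) c≡0)))
      e<2h : pred (2 * t) < 2 * h
      e<2h = begin-strict
        pred (2 * t) <⟨ ≤-reflexive (suc-pred (2 * t) {{>-nonZero (≤-trans (s≤s z≤n) (*-monoʳ-≤ 2 2≤t))}}) ⟩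
        2 * t        ≤⟨ *-monoʳ-≤ 2 (m≤n*m t c {{>-nonZero 1≤c}}) ⟩
        2 * (c * t)  ≡⟨ cong (2 *_) h≡ct ⟨
        2 * h        ∎
        where open ≤-Reasoning

  Cut⇒NonPrimitivePair : ∀ {e z} → Cut e z → NonPrimitivePair z
  Cut⇒NonPrimitivePair (inΛ , v , (|v|≡ , prim-v) , refl) with c , t , d≡2t , h≡ct , 2≤t , 3∤t ← InΛ⁺-elim inΛ =
    subst NonPrimitivePair (cong (λ m → splitAt h (v ^^ m)) (sym t≡))
      (NonPrimitivePair-splitAt {c} v prim-v (trans |v|≡ |v|≡3c) h≡ct 2≤t 3∤t)
    where
    quotients = Λ⁺-quotients {h} {c} d≡2t h≡ct
    t≡ = proj₁ quotients
    |v|≡3c = proj₂ quotients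

  NonPrimitivePair⇔⋃Cut : ∀ z → (∃[ e ] (e ∈ upTo (2 * h) × Cut e z)) ⇔ NonPrimitivePair z
  NonPrimitivePair⇔⋃Cut (x , q) = mk⇔ (λ (_ , _ , cut) → Cut⇒NonPrimitivePair cut) split-power
    where
    split-power : NonPrimitivePair (x , q) → ∃[ e ] (e ∈ upTo (2 * h) × Cut e (x , q))
    split-power (pair@(_ , _ , prim-q) , ¬prim) with v , t , prim-v , 2≤t , xq≡v^t ←
      ¬Primitive⇒power-of-primitive (λ xq≡[] → proj₁ prim-q (++-conicalʳ x q xq≡[])) ¬prim =
      power⇒Cut pair prim-v 2≤t xq≡v^t

  attach⇔E₁ : 1 ≤ h → ∀ w → (∃[ z ] ((PrefixPair z × Primitive (proj₁ z ++ proj₂ z)) × w ≡ attach z)) ⇔ E₁ n (2 * h) w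
  attach⇔E₁ 1≤h (p , q) = mk⇔ image⇒E₁ E₁⇒image
    where
    image⇒E₁ : (∃[ z ] ((PrefixPair z × Primitive (proj₁ z ++ proj₂ z)) × (p , q) ≡ attach z)) → E₁ n (2 * h) (p , q)
    image⇒E₁ ((x , .q) , ((|x|≡h , |q|≡2h , prim-q) , prim-xq) , refl) =
      (Primitive-++-prefix x q |q|≡2|x| prim-xq , prim-q , |xqx|≡4h , |q|≡2h , ¬prim-square) ,
      x , x≢[] , refl , prim-xq , |q|≡2|x|
      where
      |q|≡2|x| = trans |q|≡2h (cong (2 *_) (sym |x|≡h))
      x≢[] : x ≢ []
      x≢[] x≡[] with () ← subst (1 ≤_) (trans (sym |x|≡h) (cong length x≡[])) 1≤h
      |xqx|≡4h : length (x ++ q ++ x) ≡ 2 * (2 * h)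
      |xqx|≡4h = trans (length-++ x) (trans (cong (length x +_) (length-++ q))
                   (trans (cong₂ (λ a b → a + (b + a)) |x|≡h |q|≡2h) (lemma h)))
        where
        lemma : ∀ h → h + (2 * h + h) ≡ 2 * (2 * h)
        lemma = solve-∀
      square : (x ++ q ++ x) ++ q ≡ (x ++ q) ^^ 2
      square = begin
        (x ++ q ++ x) ++ q         ≡⟨ ++-assoc x (q ++ x) q ⟩
        x ++ (q ++ x) ++ q         ≡⟨ cong (x ++_) (++-assoc q x q) ⟩
        x ++ q ++ x ++ q           ≡⟨ ++-assoc x q (x ++ q) ⟨
        (x ++ q) ++ x ++ q         ≡⟨ cong ((x ++ q) ++_) (++-identityʳ (x ++ q)) ⟨
        (x ++ q) ^^ 2              ∎
        where open ≡-Reasoning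
      ¬prim-square = subst (λ w → ¬ Primitive w) (sym square) (¬Primitive-^^ (x ++ q) {2} (s≤s (s≤s z≤n)))
    E₁⇒image : E₁ n (2 * h) (p , q) → ∃[ z ] ((PrefixPair z × Primitive (proj₁ z ++ proj₂ z)) × (p , q) ≡ attach z)
    E₁⇒image ((_ , prim-q , _ , |q|≡2h , _) , x , _ , p≡xqx , prim-xq , |q|≡2|x|) =
      (x , q) , ((*-cancelˡ-≡ (length x) h 2 (trans (sym |q|≡2|x|) |q|≡2h) , |q|≡2h , prim-q) , prim-xq) , cong (_, q) p≡xqx

module _ {n : ℕ} (π : ℕ → ℕ) (π-counts : ∀ k → HasCount (PrimOfLength n k) (π k)) (h : ℕ) where

  count-Cut : ∀ e → HasCount (Cut h e) (Λ⁺term π (2 * h) (suc e))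
  count-Cut e with inΛ⁺? (2 * h) (suc e)
  ... | yes inΛ = HasCount-cong (λ z → mk⇔ (inΛ ,_) proj₂)
                    (HasCount-image (λ v → splitAt h (v ^^ (suc e / 2))) cut-injective (π-counts (3 * (2 * h) / suc e)))
    where
    cut-injective : ∀ {v w : Word n} → splitAt h (v ^^ (suc e / 2)) ≡ splitAt h (w ^^ (suc e / 2)) → v ≡ w
    cut-injective {v} {w} eq with c , t , d≡2t , h≡ct , 2≤t , _ ← InΛ⁺-elim inΛ =
      ^^-cancelʳ v w (≤-trans (s≤s z≤n) 2≤t)
        (subst (λ m → v ^^ m ≡ w ^^ m) (proj₁ (Λ⁺-quotients {h} {c} d≡2t h≡ct)) (splitAt-injective h eq))
  ... | no ¬inΛ = HasCount-∅ λ _ (inΛ , _) → ¬inΛ inΛ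

  count-E₁ : 1 ≤ h → HasCount (E₁ n (2 * h)) (n ^ h * π (2 * h) ∸ Λ⁺Sum π (2 * h))
  count-E₁ 1≤h =
    HasCount-cong (attach⇔E₁ h 1≤h) (HasCount-image attach attach-injective
      (HasCount-∖ (λ z → primitive? (proj₁ z ++ proj₂ z)) prefix-pairs non-primitive-pairs))
    where
    prefix-pairs : HasCount (PrefixPair h) (n ^ h * π (2 * h))
    prefix-pairs = HasCount-× (HasCount-length h) (π-counts (2 * h))
    non-primitive-pairs : HasCount (NonPrimitivePair h) (Λ⁺Sum π (2 * h))
    non-primitive-pairs =
      HasCount-cong (NonPrimitivePair⇔⋃Cut h) (HasCount-⋃ (upTo (2 * h)) (Unique.upTo⁺ (2 * h)) count-Cut (Cut-disjoint h))

proposition3p5 : (n l : ℕ) → 2 ≤ n → 0 < l → 2 ∣ l →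
    (π : ℕ → ℕ) → (∀ k → HasCount (PrimOfLength n k) (π k)) →
    HasCount (E₁ n l) (n ^ (l / 2) * π l ∸ Λ⁺Sum π l)
proposition3p5 n l _ 0<l (divides h refl) π π-counts =
  subst₂ (λ l k → HasCount (E₁ n l) (n ^ k * π l ∸ Λ⁺Sum π l)) (*-comm 2 h) (sym (m*n/n≡m h 2))
    (count-E₁ π π-counts h (n≢0⇒n>0 λ h≡0 → <⇒≢ 0<l (sym (cong (_* 2) h≡0))))
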